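{- Let $\phi\colon F\to G$ be an oddomorphism. Let $s\in V(F)$ and let $C_1,\dots,C_n$ be (the vertex sets of) the connected components of $F-s$. If the graph $G-\phi(s)$ is connected, then there exist $i\in[n]$ and an oddomorphism $\phi_i\colon F[C_i\cup\{s\}]\to G$ such that (1) $\phi_i(a)=\phi(a)$ for all $a\in C_i\cup\{s\}$; (2) for all $a\in C_i$, the vertex $a$ is $\phi$-odd if and only if it is $\phi_i$-odd; (3) if $s$ is $\phi_i$-odd, then there exists a $\phi$-odd vertex $s^*\in V(F)\setminus C_i$ with $\phi(s^*)=\phi(s)$.
   Context: All graphs are finite, simple, undirected and loopless. Let $\phi\colon F\to G$ be a homomorphism. A vertex $a\in V(F)$ is $\phi$-odd (resp. $\phi$-even) if $|N_F(a)\cap\phi^{ -1}(v)|$ is odd (resp. even) for every $v\in N_G(\phi(a))$. $\phi$ is an oddomorphism if every vertex of $F$ is $\phi$-odd or $\phi$-even and every fibre $\phi^{ -1}(v)$, $v\in V(G)$, contains an odd number of $\phi$-odd vertices. -}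

module Defs where

open import Data.Nat using (ℕ; zero; suc; _+_; _%_)
open import Data.Bool using (Bool; true; false; T; _∧_; _∨_; not; if_then_else_)
open import Data.Fin using (Fin; zero; suc; _≟_)
open import Data.Product using (Σ; _×_; _,_)
open import Data.Sum using (_⊎_)
open import Relation.Nullary using (¬_)
open import Relation.Nullary.Decidable using (isYes)
open import Relation.Binary.PropositionalEquality using (_≡_)

record Graph : Set where
  field
    n      : ℕ
    adj    : Fin n → Fin n → Bool
    sym    : ∀ a b → adj a b ≡ adj b a
    irrefl : ∀ a → adj a a ≡ false
open Graph public

V : Graph → Set
V F = Fin (n F)

Subset : Graph → Set
Subset F = V F → Bool

full : (F : Graph) → Subset F
full F _ = true

count : ∀ {k} → (Fin k → Bool) → ℕ
count {zero}  f = 0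
count {suc k} f = (if f zero then 1 else 0) + count (λ i → f (suc i))

allᵇ : ∀ {k} → (Fin k → Bool) → Bool
allᵇ {zero}  f = true
allᵇ {suc k} f = f zero ∧ allᵇ (λ i → f (suc i))

oddᵇ : ℕ → Bool
oddᵇ k = isYes (k % 2 Data.Nat.≟ 1)

evenᵇ : ℕ → Bool
evenᵇ k = not (oddᵇ k)

module _ (F G : Graph) (S : Subset F) (φ : V F → V G) where

  IsHom : Set
  IsHom = ∀ a b → T (S a) → T (S b) → T (adj F a b) → T (adj G (φ a) (φ b))

  nbrFibre : V F → V G → ℕ
  nbrFibre a v = count (λ b → S b ∧ (adj F a b ∧ isYes (φ b ≟ v)))

  isOddᵇ : V F → Bool
  isOddᵇ a = allᵇ (λ v → not (adj G (φ a) v) ∨ oddᵇ (nbrFibre a v))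

  isEvenᵇ : V F → Bool
  isEvenᵇ a = allᵇ (λ v → not (adj G (φ a) v) ∨ evenᵇ (nbrFibre a v))

  IsOddVertex : V F → Set
  IsOddVertex a = T (isOddᵇ a)

  IsEvenVertex : V F → Set
  IsEvenVertex a = T (isEvenᵇ a)

  -- φ restricted to S is an oddomorphism F[S] → G
  IsOddomorphism : Set
  IsOddomorphism =
    IsHom ×
    (∀ a → T (S a) → IsOddVertex a ⊎ IsEvenVertex a) ×
    (∀ v → count (λ a → S a ∧ (isOddᵇ a ∧ isYes (φ a ≟ v))) % 2 ≡ 1)

data Reach (G : Graph) (P : Subset G) : V G → V G → Set where
  here : ∀ {a} → T (P a) → Reach G P a a
  step : ∀ {a b c} → T (P a) → T (adj G a b) → Reach G P b c → Reach G P a c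

minus : (G : Graph) → V G → Subset G
minus G x y = not (isYes (y ≟ x))

-- G - x is connected (connected graphs are non-empty, as usual)
ConnectedMinus : (G : Graph) → V G → Set
ConnectedMinus G x =
  Σ (V G) (λ u → ¬ u ≡ x) ×
  (∀ u w → ¬ u ≡ x → ¬ w ≡ x → Reach G (minus G x) u w)

IsComponentMinus : (F : Graph) → V F → Subset F → Set
IsComponentMinus F s C =
  Σ (V F) (λ c → ¬ c ≡ s ×
    (∀ b → (T (C b) → Reach F (minus F s) c b) × (Reach F (minus F s) c b → T (C b))))

insert : (F : Graph) → Subset F → V F → Subset F
insert F C s b = C b ∨ isYes (b ≟ s)

module Submission where

-- Fix v₀ ≠ φ(s). The odd vertices over v₀ form an odd set, and the components of F − s partition
-- it, so some component C contains an odd number of them. Counting modulo 2 the edges between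
-- C ∩ φ⁻¹(v) and C ∩ φ⁻¹(w) for adjacent v, w ≠ φ(s) shows that the number of odd vertices of C
-- over v is constant along G − φ(s); as that graph is connected, it is odd for every v ≠ φ(s).
-- The same count between (C ∪ {s}) ∩ φ⁻¹(φ(s)) and C ∩ φ⁻¹(v) gives |N(s) ∩ C ∩ φ⁻¹(v)| ≡ 1 + q
-- for every neighbour v of φ(s), where q is the number of odd vertices of C over φ(s). So s is
-- odd in F[C ∪ {s}] exactly when q is even, which makes the fibre over φ(s) odd as well; and then
-- the odd fibre of φ over φ(s) must contain an odd vertex outside C.

open import Defs renaming (sym to adj-sym; irrefl to adj-irrefl)
open import Algebra.Bundles using (CommutativeMonoid; CommutativeRing)
open import Data.Bool using (Bool; true; false; T; _∧_; _∨_; not; _xor_)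
open import Data.Bool.Properties
  using ( ∧-assoc; ∧-zeroʳ; ∧-identityʳ; ∨-identityʳ; xor-identityʳ; xor-inverseʳ; not-involutive
        ; ∧-commutativeMonoid; xor-∧-commutativeRing; ⇔→≡; T?; T-≡; T-not-≡; T-∧; T-∨ )
open import Data.Empty using (⊥-elim)
open import Data.Fin using (Fin; zero; suc; _≟_)
open import Data.Fin.Properties using (any?; all?; ¬∀⟶∃¬)
open import Data.Nat using (ℕ; zero; suc; _≤_; _<_; _%_; z≤n; s≤s)
open import Data.Nat.GeneralisedArithmetic using (fold)
open import Data.Nat.Properties using (≤-trans; m≤n⇒m≤1+n; 1+n≰n)
open import Data.Product using (Σ; ∃-syntax; _×_; _,_; proj₁; proj₂)
open import Data.Sum using (_⊎_; inj₁; inj₂; map₂)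
open import Data.Unit using (tt)
open import Function using (_∘_; _⇔_; mk⇔; Equivalence)
open import Relation.Nullary using (¬_; Dec; yes; no)
open import Relation.Nullary.Decidable using (isYes; toWitness; fromWitness)
open import Relation.Binary.PropositionalEquality
  using (_≡_; refl; sym; trans; cong; cong₂; subst; module ≡-Reasoning)

open import Algebra.Properties.CommutativeSemigroup
  (CommutativeMonoid.commutativeSemigroup ∧-commutativeMonoid)
  using (x∙yz≈y∙xz; x∙yz≈xz∙y; x∙yz≈z∙yx)
open import Algebra.Properties.CommutativeSemigroup
  (CommutativeRing.+-commutativeSemigroup xor-∧-commutativeRing)
  using () renaming (interchange to xor-interchange)

open ≡-Reasoning
open Equivalence using (to; from)

_∩_ : ∀ {k} → (Fin k → Bool) → (Fin k → Bool) → Fin k → Bool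
(A ∩ B) i = A i ∧ B i

∧-absorbˡ : ∀ x y → (T y → T x) → x ∧ y ≡ y
∧-absorbˡ true  y y⇒x = refl
∧-absorbˡ false true y⇒x = ⊥-elim (y⇒x tt)
∧-absorbˡ false false y⇒x = refl

xor-cancel : ∀ a r t → (a xor r) xor (r xor t) ≡ a xor t
xor-cancel true  true  t = refl
xor-cancel true  false t = refl
xor-cancel false true  t = not-involutive t
xor-cancel false false t = refl

xor≡true⇒≡not : ∀ q t → q xor t ≡ true → t ≡ not q
xor≡true⇒≡not true  false _ = refl
xor≡true⇒≡not false true  _ = refl

isYes-suc≟suc : ∀ {k} (i j : Fin k) → isYes (suc i ≟ suc j) ≡ isYes (i ≟ j)
isYes-suc≟suc i j with i ≟ j
... | yes _ = refl
... | no  _ = refl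

T-allᵇ : ∀ {k} {f : Fin k → Bool} → T (allᵇ f) ⇔ (∀ i → T (f i))
T-allᵇ = mk⇔ elim intro
  where
  elim : ∀ {k} {f : Fin k → Bool} → T (allᵇ f) → ∀ i → T (f i)
  elim t zero    = proj₁ (to T-∧ t)
  elim t (suc i) = elim (proj₂ (to T-∧ t)) i
  intro : ∀ {k} {f : Fin k → Bool} → (∀ i → T (f i)) → T (allᵇ f)
  intro {zero}  _ = tt
  intro {suc k} h = from T-∧ (h zero , intro (h ∘ suc))

T-⇒ᵇ : ∀ {a b} → T (not a ∨ b) ⇔ (T a → T b)
T-⇒ᵇ {true}  = mk⇔ (λ b _ → b) (λ a⇒b → a⇒b tt)
T-⇒ᵇ {false} = mk⇔ (λ _ ()) (λ _ → tt)

T-guarded-allᵇ : ∀ {k} {g f : Fin k → Bool} →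
  T (allᵇ (λ i → not (g i) ∨ f i)) ⇔ (∀ i → T (g i) → T (f i))
T-guarded-allᵇ = mk⇔ (λ t i → to T-⇒ᵇ (to T-allᵇ t i)) (λ h → from T-allᵇ (λ i → from T-⇒ᵇ (h i)))

allᵇ-cong : ∀ {k} {f g : Fin k → Bool} → (∀ i → f i ≡ g i) → allᵇ f ≡ allᵇ g
allᵇ-cong {zero}  _   = refl
allᵇ-cong {suc k} f≗g = cong₂ _∧_ (f≗g zero) (allᵇ-cong (f≗g ∘ suc))

parity : ∀ {k} → (Fin k → Bool) → Bool
parity {zero}  f = false
parity {suc k} f = f zero xor parity (f ∘ suc)

parity-cong : ∀ {k} {f g : Fin k → Bool} → (∀ i → f i ≡ g i) → parity f ≡ parity g
parity-cong {zero}  _   = refl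
parity-cong {suc k} f≗g = cong₂ _xor_ (f≗g zero) (parity-cong (f≗g ∘ suc))

parity-false : ∀ {k} {f : Fin k → Bool} → (∀ i → f i ≡ false) → parity f ≡ false
parity-false {zero}  _ = refl
parity-false {suc k} f≡false rewrite f≡false zero = parity-false (f≡false ∘ suc)

parity-xor : ∀ {k} (f g : Fin k → Bool) → parity (λ i → f i xor g i) ≡ parity f xor parity g
parity-xor {zero}  f g = refl
parity-xor {suc k} f g = begin
  (f zero xor g zero) xor parity (λ i → f (suc i) xor g (suc i))
    ≡⟨ cong ((f zero xor g zero) xor_) (parity-xor (f ∘ suc) (g ∘ suc)) ⟩
  (f zero xor g zero) xor (parity (f ∘ suc) xor parity (g ∘ suc))
    ≡⟨ xor-interchange (f zero) (g zero) _ _ ⟩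
  (f zero xor parity (f ∘ suc)) xor (g zero xor parity (g ∘ suc)) ∎

parity-∧ˡ : ∀ {k} b (f : Fin k → Bool) → parity (λ i → b ∧ f i) ≡ b ∧ parity f
parity-∧ˡ true  f = refl
parity-∧ˡ {k} false f = parity-false {k} (λ _ → refl)

parity-comm : ∀ {k m} (M : Fin k → Fin m → Bool) →
  parity (λ i → parity (M i)) ≡ parity (λ j → parity (λ i → M i j))
parity-comm {zero} {m} M = sym (parity-false {m} (λ _ → refl))
parity-comm {suc k} M = begin
  parity (M zero) xor parity (λ i → parity (M (suc i)))
    ≡⟨ cong (parity (M zero) xor_) (parity-comm (M ∘ suc)) ⟩
  parity (M zero) xor parity (λ j → parity (λ i → M (suc i) j))
    ≡⟨ sym (parity-xor (M zero) _) ⟩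
  parity (λ j → parity (λ i → M i j)) ∎

-- Off-diagonal entries of a symmetric matrix cancel in pairs.
parity-symmetric : ∀ {k} (M : Fin k → Fin k → Bool) → (∀ i j → M i j ≡ M j i) →
  parity (λ i → parity (M i)) ≡ parity (λ i → M i i)
parity-symmetric {zero}  M M-sym = refl
parity-symmetric {suc k} M M-sym = begin
  (M zero zero xor row) xor parity (λ i → M (suc i) zero xor parity (M (suc i) ∘ suc))
    ≡⟨ cong ((M zero zero xor row) xor_)
            (parity-xor (λ i → M (suc i) zero) (λ i → parity (M (suc i) ∘ suc))) ⟩
  (M zero zero xor row) xor (parity (λ i → M (suc i) zero) xor rest)
    ≡⟨ cong (λ col → (M zero zero xor row) xor (col xor rest))
            (parity-cong (λ i → M-sym (suc i) zero)) ⟩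
  (M zero zero xor row) xor (row xor rest)
    ≡⟨ xor-cancel (M zero zero) row rest ⟩
  M zero zero xor rest
    ≡⟨ cong (M zero zero xor_)
            (parity-symmetric (λ i j → M (suc i) (suc j)) (λ i j → M-sym (suc i) (suc j))) ⟩
  M zero zero xor parity (λ i → M (suc i) (suc i)) ∎
  where
  row  = parity (M zero ∘ suc)
  rest = parity (λ i → parity (M (suc i) ∘ suc))

parity-witness : ∀ {k} (f : Fin k → Bool) → parity f ≡ true → ∃[ i ] T (f i)
parity-witness {suc k} f odd with f zero in f₀
... | true  = zero , from T-≡ f₀
... | false with parity-witness (f ∘ suc) odd
...   | i , fi = suc i , fi

parity-single : ∀ {k} (j : Fin k) (f : Fin k → Bool) → parity (λ i → isYes (i ≟ j) ∧ f i) ≡ f j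
parity-single {suc k} zero f =
  trans (cong (f zero xor_) (parity-false {k} (λ _ → refl))) (xor-identityʳ (f zero))
parity-single (suc j) f = begin
  parity (λ i → isYes (suc i ≟ suc j) ∧ f (suc i))
    ≡⟨ parity-cong (λ i → cong (_∧ f (suc i)) (isYes-suc≟suc i j)) ⟩
  parity (λ i → isYes (i ≟ j) ∧ f (suc i))
    ≡⟨ parity-single j (f ∘ suc) ⟩
  f (suc j) ∎

parity-insert : ∀ {k} (S : Fin k → Bool) (j : Fin k) (f : Fin k → Bool) → ¬ T (S j) →
  parity (λ i → (S i ∨ isYes (i ≟ j)) ∧ f i) ≡ parity (λ i → S i ∧ f i) xor f j
parity-insert S j f j∉S = begin
  parity (λ i → (S i ∨ isYes (i ≟ j)) ∧ f i)
    ≡⟨ parity-cong split ⟩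
  parity (λ i → (S i ∧ f i) xor (isYes (i ≟ j) ∧ f i))
    ≡⟨ parity-xor (λ i → S i ∧ f i) (λ i → isYes (i ≟ j) ∧ f i) ⟩
  parity (λ i → S i ∧ f i) xor parity (λ i → isYes (i ≟ j) ∧ f i)
    ≡⟨ cong (parity (λ i → S i ∧ f i) xor_) (parity-single j f) ⟩
  parity (λ i → S i ∧ f i) xor f j ∎
  where
  split : ∀ i → (S i ∨ isYes (i ≟ j)) ∧ f i ≡ (S i ∧ f i) xor (isYes (i ≟ j) ∧ f i)
  split i with i ≟ j | S i in Sᵢ
  ... | yes refl | true  = ⊥-elim (j∉S (from T-≡ Sᵢ))
  ... | yes refl | false = refl
  ... | no  _    | true  = sym (xor-identityʳ (f i))
  ... | no  _    | false = refl

parity-split : ∀ {k} (S f : Fin k → Bool) →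
  parity f ≡ parity (λ i → S i ∧ f i) xor parity (λ i → not (S i) ∧ f i)
parity-split S f = trans (parity-cong split) (parity-xor (λ i → S i ∧ f i) (λ i → not (S i) ∧ f i))
  where
  split : ∀ i → f i ≡ (S i ∧ f i) xor (not (S i) ∧ f i)
  split i with S i
  ... | true  = sym (xor-identityʳ (f i))
  ... | false = refl

∃-odd-row : ∀ {k} (O : Fin k → Bool) (R : Fin k → Fin k → Bool) →
  (∀ i j → R i j ≡ R j i) → (∀ i → T (O i) → T (R i i)) → parity O ≡ true →
  ∃[ i ] T (O i) × parity (λ j → R i j ∧ O j) ≡ true
∃-odd-row O R R-sym R-refl odd =
  let i , t = parity-witness _ total
      Oᵢ , oddClass = to T-∧ t
  in i , Oᵢ , to T-≡ oddClass
  where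
  M : Fin _ → Fin _ → Bool
  M i j = O i ∧ (R i j ∧ O j)
  diagonal : ∀ i → M i i ≡ O i
  diagonal i with O i in Oᵢ
  ... | false = refl
  ... | true  = trans (∧-identityʳ (R i i)) (to T-≡ (R-refl i (from T-≡ Oᵢ)))
  total : parity (λ i → O i ∧ parity (λ j → R i j ∧ O j)) ≡ true
  total = begin
    parity (λ i → O i ∧ parity (λ j → R i j ∧ O j))
      ≡⟨ parity-cong (λ i → sym (parity-∧ˡ (O i) (λ j → R i j ∧ O j))) ⟩
    parity (λ i → parity (M i))
      ≡⟨ parity-symmetric M (λ i j → trans (cong (λ r → O i ∧ (r ∧ O j)) (R-sym i j))
                                            (x∙yz≈z∙yx (O i) (R j i) (O j))) ⟩
    parity (λ i → M i i)
      ≡⟨ parity-cong diagonal ⟩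
    parity O
      ≡⟨ odd ⟩
    true ∎

oddᵇ-suc : ∀ m → oddᵇ (suc m) ≡ not (oddᵇ m)
oddᵇ-suc zero = refl
oddᵇ-suc (suc zero) = refl
oddᵇ-suc (suc (suc m)) = oddᵇ-suc m

oddᵇ-count : ∀ {k} (f : Fin k → Bool) → oddᵇ (count f) ≡ parity f
oddᵇ-count {zero}  f = refl
oddᵇ-count {suc k} f with f zero
... | true  = trans (oddᵇ-suc (count (f ∘ suc))) (cong not (oddᵇ-count (f ∘ suc)))
... | false = oddᵇ-count (f ∘ suc)

count%2≡1⇔parity : ∀ {k} (f : Fin k → Bool) → count f % 2 ≡ 1 ⇔ parity f ≡ true
count%2≡1⇔parity f = mk⇔
  (λ odd → trans (sym (oddᵇ-count f)) (to T-≡ (fromWitness odd)))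
  (λ odd → toWitness (from T-≡ (trans (oddᵇ-count f) odd)))

_⊆_ : ∀ {k} → (Fin k → Bool) → (Fin k → Bool) → Set
A ⊆ B = ∀ i → T (A i) → T (B i)

count≤size : ∀ {k} (f : Fin k → Bool) → count f ≤ k
count≤size {zero}  f = z≤n
count≤size {suc k} f with f zero
... | true  = s≤s (count≤size (f ∘ suc))
... | false = m≤n⇒m≤1+n (count≤size (f ∘ suc))

count-mono : ∀ {k} {A B : Fin k → Bool} → A ⊆ B → count A ≤ count B
count-mono {zero} A⊆B = z≤n
count-mono {suc k} {A} {B} A⊆B with A zero in A₀ | B zero in B₀
... | true  | true  = s≤s (count-mono (A⊆B ∘ suc))
... | true  | false = ⊥-elim (subst T B₀ (A⊆B zero (from T-≡ A₀)))
... | false | true  = m≤n⇒m≤1+n (count-mono (A⊆B ∘ suc))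
... | false | false = count-mono (A⊆B ∘ suc)

count-mono-< : ∀ {k} {A B : Fin k → Bool} → A ⊆ B → ∀ j → ¬ T (A j) → T (B j) → count A < count B
count-mono-< {suc k} {A} {B} A⊆B zero j∉A j∈B with A zero | B zero
... | true  | _     = ⊥-elim (j∉A tt)
... | false | false = ⊥-elim j∈B
... | false | true  = s≤s (count-mono (A⊆B ∘ suc))
count-mono-< {suc k} {A} {B} A⊆B (suc j) j∉A j∈B with A zero in A₀ | B zero in B₀
... | true  | true  = s≤s (count-mono-< (A⊆B ∘ suc) j j∉A j∈B)
... | true  | false = ⊥-elim (subst T B₀ (A⊆B zero (from T-≡ A₀)))
... | false | true  = m≤n⇒m≤1+n (count-mono-< (A⊆B ∘ suc) j j∉A j∈B)
... | false | false = count-mono-< (A⊆B ∘ suc) j j∉A j∈B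

-- Each non-closed step adds an element, so the (k+1)-st iterate is closed.
module Iteration {k : ℕ} (step : (Fin k → Bool) → Fin k → Bool)
  (inflationary : ∀ A → A ⊆ step A)
  (monotone : ∀ {A B} → A ⊆ B → step A ⊆ step B)
  (start : Fin k → Bool) where

  iterate : ℕ → Fin k → Bool
  iterate = fold start step

  private
    start⊆iterate : ∀ m → start ⊆ iterate m
    start⊆iterate zero    i s = s
    start⊆iterate (suc m) i s = inflationary (iterate m) i (start⊆iterate m i s)

    Closed : ℕ → Set
    Closed m = step (iterate m) ⊆ iterate m

    closed-or-grows : ∀ m → Closed m ⊎ suc (count (iterate m)) ≤ count (iterate (suc m))
    closed-or-grows m with all? (λ i → T? (not (step (iterate m) i) ∨ iterate m i))
    ... | yes closed = inj₁ (λ i → to T-⇒ᵇ (closed i))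
    ... | no ¬closed with ¬∀⟶∃¬ k _ (λ i → T? (not (step (iterate m) i) ∨ iterate m i)) ¬closed
    ...   | i , ¬imp = inj₂ (count-mono-< (inflationary (iterate m)) i (old ¬imp) (new ¬imp))
      where
      old : ∀ {a b} → ¬ T (not a ∨ b) → ¬ T b
      old ¬imp b = ¬imp (from T-⇒ᵇ (λ _ → b))
      new : ∀ {a b} → ¬ T (not a ∨ b) → T a
      new {true}  _    = tt
      new {false} ¬imp = ¬imp tt

    closed-or-large : ∀ m → Closed m ⊎ m ≤ count (iterate m)
    closed-or-large zero = inj₂ z≤n
    closed-or-large (suc m) with closed-or-large m | closed-or-grows m
    ... | inj₁ closed | _           = inj₁ (monotone closed)
    ... | inj₂ _      | inj₁ closed = inj₁ (monotone closed)
    ... | inj₂ large  | inj₂ grows  = inj₂ (≤-trans (s≤s large) grows)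

  fixpoint : Fin k → Bool
  fixpoint = iterate (suc k)

  fixpoint-closed : step fixpoint ⊆ fixpoint
  fixpoint-closed with closed-or-large (suc k)
  ... | inj₁ closed = closed
  ... | inj₂ large  = ⊥-elim (1+n≰n (≤-trans large (count≤size fixpoint)))

  start⊆fixpoint : start ⊆ fixpoint
  start⊆fixpoint = start⊆iterate (suc k)

  fixpoint-induction : (Q : Fin k → Set) → (∀ i → T (start i) → Q i) →
    (∀ A → (∀ i → T (A i) → Q i) → ∀ i → T (step A i) → Q i) →
    ∀ i → T (fixpoint i) → Q i
  fixpoint-induction Q base ind = induction (suc k)
    where
    induction : ∀ m i → T (iterate m i) → Q i
    induction zero    = base
    induction (suc m) = ind (iterate m) (induction m)

module _ {H : Graph} {P : Subset H} where

  reach-start : ∀ {a b} → Reach H P a b → T (P a)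
  reach-start (here Pa)     = Pa
  reach-start (step Pa _ _) = Pa

  reach-end : ∀ {a b} → Reach H P a b → T (P b)
  reach-end (here Pb)    = Pb
  reach-end (step _ _ r) = reach-end r

  reach-snoc : ∀ {a b c} → Reach H P a b → T (P c) → T (adj H b c) → Reach H P a c
  reach-snoc (here Pa)      Pc bc = step Pa bc (here Pc)
  reach-snoc (step Pa ab r) Pc bc = step Pa ab (reach-snoc r Pc bc)

  reach-trans : ∀ {a b c} → Reach H P a b → Reach H P b c → Reach H P a c
  reach-trans (here _)       r′ = r′
  reach-trans (step Pa ab r) r′ = step Pa ab (reach-trans r r′)

  reach-sym : ∀ {a b} → Reach H P a b → Reach H P b a
  reach-sym (here Pa) = here Pa
  reach-sym (step {a} {b} Pa ab r) = reach-snoc (reach-sym r) Pa (subst T (adj-sym H a b) ab)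

  reach-from-isolated : ∀ {a b} → (∀ c → ¬ T (adj H a c)) → Reach H P a b → a ≡ b
  reach-from-isolated isolated (here _)       = refl
  reach-from-isolated isolated (step _ ab _) = ⊥-elim (isolated _ ab)

grow : (H : Graph) → Subset H → Subset H → Subset H
grow H P A b = A b ∨ (P b ∧ isYes (any? (λ a → T? (A a ∧ adj H a b))))

T-grow : ∀ H P A b → T (grow H P A b) ⇔ (T (A b) ⊎ T (P b) × ∃[ a ] T (A a) × T (adj H a b))
T-grow H P A b = mk⇔ split join
  where
  split : T (grow H P A b) → T (A b) ⊎ T (P b) × ∃[ a ] T (A a) × T (adj H a b)
  split t with to (T-∨ {A b}) t
  ... | inj₁ Ab = inj₁ Ab
  ... | inj₂ t′ with to (T-∧ {P b}) t′
  ...   | Pb , ∃edge with toWitness ∃edge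
  ...     | a , e = inj₂ (Pb , a , to T-∧ e)
  join : T (A b) ⊎ T (P b) × ∃[ a ] T (A a) × T (adj H a b) → T (grow H P A b)
  join (inj₁ Ab)                = from (T-∨ {A b}) (inj₁ Ab)
  join (inj₂ (Pb , a , Aa , ab)) =
    from (T-∨ {A b}) (inj₂ (from T-∧ (Pb , fromWitness (a , from T-∧ (Aa , ab)))))

module Reachability (H : Graph) (P : Subset H) where

  private
    grow-inflationary : ∀ A → A ⊆ grow H P A
    grow-inflationary A b Ab = from (T-grow H P A b) (inj₁ Ab)

    grow-monotone : ∀ {A B} → A ⊆ B → grow H P A ⊆ grow H P B
    grow-monotone {A} {B} A⊆B b t with to (T-grow H P A b) t
    ... | inj₁ Ab                 = from (T-grow H P B b) (inj₁ (A⊆B b Ab))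
    ... | inj₂ (Pb , a , Aa , ab) = from (T-grow H P B b) (inj₂ (Pb , a , A⊆B a Aa , ab))

    module Kleene (c : V H) = Iteration (grow H P) grow-inflationary grow-monotone
                                        (λ b → P b ∧ isYes (b ≟ c))

  reachable : V H → Subset H
  reachable c = Kleene.fixpoint c

  reachable-sound : ∀ {c b} → T (reachable c b) → Reach H P c b
  reachable-sound {c} {b} = Kleene.fixpoint-induction c (Reach H P c) base ind b
    where
    base : ∀ b → T (P b ∧ isYes (b ≟ c)) → Reach H P c b
    base b t with to (T-∧ {P b}) t
    ... | Pb , b≡c rewrite toWitness b≡c = here Pb
    ind : ∀ A → (∀ b → T (A b) → Reach H P c b) → ∀ b → T (grow H P A b) → Reach H P c b
    ind A A⇒reach b t with to (T-grow H P A b) t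
    ... | inj₁ Ab                 = A⇒reach b Ab
    ... | inj₂ (Pb , a , Aa , ab) = reach-snoc (A⇒reach a Aa) Pb ab

  reachable-complete : ∀ {c b} → Reach H P c b → T (reachable c b)
  reachable-complete {c} r = go r (Kleene.start⊆fixpoint c c
                                     (from T-∧ (reach-start r , fromWitness refl)))
    where
    go : ∀ {a b} → Reach H P a b → T (reachable c a) → T (reachable c b)
    go (here _)           ca = ca
    go (step {a} {b} _ ab r) ca =
      go r (Kleene.fixpoint-closed c b
              (from (T-grow H P (reachable c) b) (inj₂ (reach-start r , a , ca , ab))))

  reachable-sym : ∀ a b → reachable a b ≡ reachable b a
  reachable-sym a b = ⇔→≡ {z = true} (mk⇔ (to T-≡ ∘ reversed ∘ from T-≡) (to T-≡ ∘ reversed ∘ from T-≡))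
    where
    reversed : ∀ {c b} → T (reachable c b) → T (reachable b c)
    reversed = reachable-complete ∘ reach-sym ∘ reachable-sound

T-minus : ∀ (H : Graph) x {b} → T (minus H x b) ⇔ (¬ b ≡ x)
T-minus H x {b} with b ≟ x
... | yes b≡x = mk⇔ (λ ()) (λ b≢x → b≢x b≡x)
... | no  b≢x = mk⇔ (λ _ → b≢x) (λ _ → tt)

T-insert : ∀ (H : Graph) S s {b} → T (insert H S s b) ⇔ (T (S b) ⊎ b ≡ s)
T-insert H S s = mk⇔ (map₂ toWitness ∘ to T-∨) (from T-∨ ∘ map₂ fromWitness)

module Component (F : Graph) (s c : V F) (c≢s : ¬ c ≡ s) where

  open Reachability F (minus F s)

  C : Subset F
  C = reachable c

  isComponent : IsComponentMinus F s C
  isComponent = c , c≢s , λ b → reachable-sound , reachable-complete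

  s∉C : ¬ T (C s)
  s∉C s∈C = to (T-minus F s) (reach-end (reachable-sound s∈C)) refl

  C-closed : ∀ {a b} → T (C a) → T (adj F a b) → T (insert F C s b)
  C-closed {a} {b} a∈C ab = from (T-insert F C s) (neighbour (b ≟ s))
    where
    neighbour : Dec (b ≡ s) → T (C b) ⊎ b ≡ s
    neighbour (yes b≡s) = inj₂ b≡s
    neighbour (no  b≢s) =
      inj₁ (reachable-complete (reach-snoc (reachable-sound a∈C) (from (T-minus F s) b≢s) ab))

  C-connected : ∀ {a b} → T (C a) → T (C b) → Reach F (minus F s) a b
  C-connected a∈C b∈C = reach-trans (reach-sym (reachable-sound a∈C)) (reachable-sound b∈C)

nbrParity : (F : Graph) → Subset F → V F → Bool
nbrParity F S a = parity (λ b → S b ∧ adj F a b)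

-- Both sides count, modulo 2, the edges between A and B.
handshake : (F : Graph) (A B : Subset F) →
  parity (λ a → A a ∧ nbrParity F B a) ≡ parity (λ b → B b ∧ nbrParity F A b)
handshake F A B = begin
  parity (λ a → A a ∧ nbrParity F B a)
    ≡⟨ parity-cong (λ a → sym (parity-∧ˡ (A a) (λ b → B b ∧ adj F a b))) ⟩
  parity (λ a → parity (λ b → A a ∧ (B b ∧ adj F a b)))
    ≡⟨ parity-comm (λ a b → A a ∧ (B b ∧ adj F a b)) ⟩
  parity (λ b → parity (λ a → A a ∧ (B b ∧ adj F a b)))
    ≡⟨ parity-cong (λ b → parity-cong (λ a → swap a b)) ⟩
  parity (λ b → parity (λ a → B b ∧ (A a ∧ adj F b a)))
    ≡⟨ parity-cong (λ b → parity-∧ˡ (B b) (λ a → A a ∧ adj F b a)) ⟩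
  parity (λ b → B b ∧ nbrParity F A b) ∎
  where
  swap : ∀ a b → A a ∧ (B b ∧ adj F a b) ≡ B b ∧ (A a ∧ adj F b a)
  swap a b = trans (x∙yz≈y∙xz (A a) (B b) (adj F a b))
                   (cong (λ e → B b ∧ (A a ∧ e)) (adj-sym F a b))

module Fibres (F G : Graph) (φ : V F → V G) where

  fibre : V G → Subset F
  fibre v a = isYes (φ a ≟ v)

  odd : V F → Bool
  odd = isOddᵇ F G (full F) φ

  oddCount : Subset F → V G → Bool
  oddCount S v = parity (λ a → S a ∧ (odd a ∧ fibre v a))

  oddᵇ-nbrFibre : ∀ S a v → oddᵇ (nbrFibre F G S φ a v) ≡ nbrParity F (S ∩ fibre v) a
  oddᵇ-nbrFibre S a v = trans (oddᵇ-count (λ b → S b ∧ (adj F a b ∧ fibre v b)))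
    (parity-cong (λ b → x∙yz≈xz∙y (S b) (adj F a b) (fibre v b)))

  oddᵇ-nbrFibre-cong : ∀ S S′ a → (∀ b → T (adj F a b) → S b ≡ S′ b) →
    ∀ v → oddᵇ (nbrFibre F G S φ a v) ≡ oddᵇ (nbrFibre F G S′ φ a v)
  oddᵇ-nbrFibre-cong S S′ a S≗S′ v = begin
    oddᵇ (nbrFibre F G S φ a v)
      ≡⟨ oddᵇ-count (λ b → S b ∧ (adj F a b ∧ fibre v b)) ⟩
    parity (λ b → S b ∧ (adj F a b ∧ fibre v b))
      ≡⟨ parity-cong agree ⟩
    parity (λ b → S′ b ∧ (adj F a b ∧ fibre v b))
      ≡⟨ oddᵇ-count (λ b → S′ b ∧ (adj F a b ∧ fibre v b)) ⟨
    oddᵇ (nbrFibre F G S′ φ a v) ∎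
    where
    agree : ∀ b → S b ∧ (adj F a b ∧ fibre v b) ≡ S′ b ∧ (adj F a b ∧ fibre v b)
    agree b with adj F a b in ab
    ... | false = trans (∧-zeroʳ (S b)) (sym (∧-zeroʳ (S′ b)))
    ... | true  = cong (_∧ fibre v b) (S≗S′ b (from T-≡ ab))

  isOddᵇ-cong : ∀ S S′ a → (∀ b → T (adj F a b) → S b ≡ S′ b) →
    isOddᵇ F G S φ a ≡ isOddᵇ F G S′ φ a
  isOddᵇ-cong S S′ a S≗S′ =
    allᵇ-cong (λ v → cong (not (adj G (φ a) v) ∨_) (oddᵇ-nbrFibre-cong S S′ a S≗S′ v))

  isEvenᵇ-cong : ∀ S S′ a → (∀ b → T (adj F a b) → S b ≡ S′ b) →
    isEvenᵇ F G S φ a ≡ isEvenᵇ F G S′ φ a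
  isEvenᵇ-cong S S′ a S≗S′ =
    allᵇ-cong (λ v → cong (λ o → not (adj G (φ a) v) ∨ not o) (oddᵇ-nbrFibre-cong S S′ a S≗S′ v))

  T-isOddᵇ : ∀ S a → IsOddVertex F G S φ a ⇔
    (∀ w → T (adj G (φ a) w) → T (oddᵇ (nbrFibre F G S φ a w)))
  T-isOddᵇ S a = T-guarded-allᵇ {g = adj G (φ a)} {f = λ w → oddᵇ (nbrFibre F G S φ a w)}

  T-isEvenᵇ : ∀ S a → IsEvenVertex F G S φ a ⇔
    (∀ w → T (adj G (φ a) w) → T (evenᵇ (nbrFibre F G S φ a w)))
  T-isEvenᵇ S a = T-guarded-allᵇ {g = adj G (φ a)} {f = λ w → evenᵇ (nbrFibre F G S φ a w)}

  oddᵇ-nbrFibre≡isOddᵇ : ∀ S a {w} → IsOddVertex F G S φ a ⊎ IsEvenVertex F G S φ a →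
    T (adj G (φ a) w) → oddᵇ (nbrFibre F G S φ a w) ≡ isOddᵇ F G S φ a
  oddᵇ-nbrFibre≡isOddᵇ S a {w} oddOrEven aw with isOddᵇ F G S φ a in isOdd | oddOrEven
  ... | true  | _         = to T-≡ (to (T-isOddᵇ S a) (from T-≡ isOdd) w aw)
  ... | false | inj₂ even = to T-not-≡ (to (T-isEvenᵇ S a) even w aw)

  isOddᵇ-isolated : ∀ S a → (∀ w → ¬ T (adj G (φ a) w)) → isOddᵇ F G S φ a ≡ true
  isOddᵇ-isolated S a isolated = to T-≡ (from (T-isOddᵇ S a) (λ w aw → ⊥-elim (isolated w aw)))

  isOddᵇ-uniform : ∀ S a β → ∃[ w ] T (adj G (φ a) w) →
    (∀ w → T (adj G (φ a) w) → oddᵇ (nbrFibre F G S φ a w) ≡ β) → isOddᵇ F G S φ a ≡ β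
  isOddᵇ-uniform S a true  _ uniform =
    to T-≡ (from (T-isOddᵇ S a) (λ w aw → from T-≡ (uniform w aw)))
  isOddᵇ-uniform S a false (w , aw) uniform with isOddᵇ F G S φ a in isOdd
  ... | false = refl
  ... | true  = trans (sym (to T-≡ (to (T-isOddᵇ S a) (from T-≡ isOdd) w aw))) (uniform w aw)

  oddOrEven-uniform : ∀ S a β → (∀ w → T (adj G (φ a) w) → oddᵇ (nbrFibre F G S φ a w) ≡ β) →
    IsOddVertex F G S φ a ⊎ IsEvenVertex F G S φ a
  oddOrEven-uniform S a true  uniform =
    inj₁ (from (T-isOddᵇ S a) (λ w aw → from T-≡ (uniform w aw)))
  oddOrEven-uniform S a false uniform =
    inj₂ (from (T-isEvenᵇ S a) (λ w aw → from T-not-≡ (uniform w aw)))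

  module _ (oddOrEven : ∀ a → IsOddVertex F G (full F) φ a ⊎ IsEvenVertex F G (full F) φ a) where

    nbrParity-fibre : ∀ S {a w} → (∀ b → T (adj F a b) → T (fibre w b) → T (S b)) →
      T (adj G (φ a) w) → nbrParity F (S ∩ fibre w) a ≡ odd a
    nbrParity-fibre S {a} {w} closed aw = begin
      nbrParity F (S ∩ fibre w) a
        ≡⟨ parity-cong absorb ⟩
      nbrParity F (full F ∩ fibre w) a
        ≡⟨ sym (oddᵇ-nbrFibre (full F) a w) ⟩
      oddᵇ (nbrFibre F G (full F) φ a w)
        ≡⟨ oddᵇ-nbrFibre≡isOddᵇ (full F) a (oddOrEven a) aw ⟩
      odd a ∎
      where
      absorb : ∀ b → (S b ∧ fibre w b) ∧ adj F a b ≡ fibre w b ∧ adj F a b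
      absorb b = trans (∧-assoc (S b) _ _) (∧-absorbˡ (S b) _ (λ t →
                   let wb , ab = to T-∧ t in closed b ab wb))

    oddCount-via-nbrParity : ∀ A B {v w} →
      (∀ a → T (A a) → T (fibre v a) → ∀ b → T (adj F a b) → T (fibre w b) → T (B b)) →
      T (adj G v w) → parity (λ a → (A ∩ fibre v) a ∧ nbrParity F (B ∩ fibre w) a) ≡ oddCount A v
    oddCount-via-nbrParity A B {v} {w} closed vw = parity-cong pointwise
      where
      pointwise : ∀ a → (A a ∧ fibre v a) ∧ nbrParity F (B ∩ fibre w) a ≡ A a ∧ (odd a ∧ fibre v a)
      pointwise a with A a in Aa | fibre v a in va
      ... | false | _     = refl
      ... | true  | false = sym (∧-zeroʳ (odd a))
      ... | true  | true  = trans
        (nbrParity-fibre B (closed a (from T-≡ Aa) (from T-≡ va))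
          (subst (λ u → T (adj G u w)) (sym (toWitness (from T-≡ va))) vw))
        (sym (∧-identityʳ (odd a)))

∃-odd-component : (F G : Graph) (φ : V F → V G) → IsOddomorphism F G (full F) φ →
  ∀ s v₀ → ¬ v₀ ≡ φ s →
  ∃[ c ] ¬ c ≡ s × Fibres.oddCount F G φ (Reachability.reachable F (minus F s) c) v₀ ≡ true
∃-odd-component F G φ (_ , _ , oddFibres) s v₀ v₀≢x =
  let c , c∈O , oddClass = ∃-odd-row O reachable reachable-sym
                             O⇒reachable (to (count%2≡1⇔parity O) (oddFibres v₀))
  in c , O⇒≢s c∈O , oddClass
  where
  open Fibres F G φ
  open Reachability F (minus F s)
  O : Subset F
  O a = odd a ∧ fibre v₀ a
  O⇒≢s : ∀ {a} → T (O a) → ¬ a ≡ s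
  O⇒≢s {a} Oa refl = v₀≢x (sym (toWitness (proj₂ (to (T-∧ {odd a}) Oa))))
  O⇒reachable : ∀ a → T (O a) → T (reachable a a)
  O⇒reachable a Oa = reachable-complete (here (from (T-minus F s) (O⇒≢s Oa)))

module Restriction (F G : Graph) (φ : V F → V G) (oddomorphism : IsOddomorphism F G (full F) φ)
  (s : V F) (connected : ConnectedMinus G (φ s))
  (C : Subset F) (s∉C : ¬ T (C s))
  (C-closed : ∀ {a b} → T (C a) → T (adj F a b) → T (insert F C s b))
  (C-connected : ∀ {a b} → T (C a) → T (C b) → Reach F (minus F s) a b)
  (C-odd-v₀ : Fibres.oddCount F G φ C (proj₁ (proj₁ connected)) ≡ true) where

  open Fibres F G φ

  private
    x : V G
    x = φ s

    v₀ : V G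
    v₀ = proj₁ (proj₁ connected)

    v₀≢x : ¬ v₀ ≡ x
    v₀≢x = proj₂ (proj₁ connected)

    hom : IsHom F G (full F) φ
    hom = proj₁ oddomorphism

    oddOrEven : ∀ a → IsOddVertex F G (full F) φ a ⊎ IsEvenVertex F G (full F) φ a
    oddOrEven a = proj₁ (proj₂ oddomorphism) a tt

  C⁺ : Subset F
  C⁺ = insert F C s

  odd⁺ : V F → Bool
  odd⁺ = isOddᵇ F G C⁺ φ

  q : Bool
  q = oddCount C x

  closed-off-x : ∀ {a b} → T (C a) → T (adj F a b) → ¬ φ b ≡ x → T (C b)
  closed-off-x a∈C ab φb≢x with to (T-insert F C s) (C-closed a∈C ab)
  ... | inj₁ b∈C  = b∈C
  ... | inj₂ refl = ⊥-elim (φb≢x refl)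

  oddCount-edge : ∀ {v w} → ¬ v ≡ x → ¬ w ≡ x → T (adj G v w) → oddCount C v ≡ oddCount C w
  oddCount-edge {v} {w} v≢x w≢x vw = begin
    oddCount C v
      ≡⟨ oddCount-via-nbrParity oddOrEven C C (closed w≢x) vw ⟨
    parity (λ a → (C ∩ fibre v) a ∧ nbrParity F (C ∩ fibre w) a)
      ≡⟨ handshake F (C ∩ fibre v) (C ∩ fibre w) ⟩
    parity (λ b → (C ∩ fibre w) b ∧ nbrParity F (C ∩ fibre v) b)
      ≡⟨ oddCount-via-nbrParity oddOrEven C C (closed v≢x) (subst T (adj-sym G v w) vw) ⟩
    oddCount C w ∎
    where
    closed : ∀ {t u} → ¬ u ≡ x →
      ∀ a → T (C a) → T (fibre t a) → ∀ b → T (adj F a b) → T (fibre u b) → T (C b)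
    closed u≢x a a∈C _ b ab bu =
      closed-off-x a∈C ab (λ φb≡x → u≢x (trans (sym (toWitness bu)) φb≡x))

  oddCount-reach : ∀ {v w} → Reach G (minus G x) v w → oddCount C v ≡ oddCount C w
  oddCount-reach (here _)       = refl
  oddCount-reach (step Pv vu r) = trans
    (oddCount-edge (to (T-minus G x) Pv) (to (T-minus G x) (reach-start r)) vu)
    (oddCount-reach r)

  oddCount-off-x : ∀ v → ¬ v ≡ x → oddCount C v ≡ true
  oddCount-off-x v v≢x =
    trans (sym (oddCount-reach (proj₂ connected v₀ v v₀≢x v≢x))) C-odd-v₀

  -- Handshake between C⁺ ∩ φ⁻¹(x) and C ∩ φ⁻¹(v): the right side is oddCount C v = 1,
  -- the left side is q plus the contribution of s.
  nbrParity-s : ∀ v → T (adj G x v) → nbrParity F (C ∩ fibre v) s ≡ not q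
  nbrParity-s v xv = xor≡true⇒≡not q (nbr s) (begin
    q xor nbr s
      ≡⟨ cong₂ _xor_ (oddCount-via-nbrParity oddOrEven C C closed xv) (cong (_∧ nbr s) s∈fibre) ⟨
    parity (λ a → (C a ∧ fibre x a) ∧ nbr a) xor (fibre x s ∧ nbr s)
      ≡⟨ cong (_xor (fibre x s ∧ nbr s)) (parity-cong (λ a → ∧-assoc (C a) (fibre x a) (nbr a))) ⟩
    parity (λ a → C a ∧ (fibre x a ∧ nbr a)) xor (fibre x s ∧ nbr s)
      ≡⟨ parity-insert C s (λ a → fibre x a ∧ nbr a) s∉C ⟨
    parity (λ a → C⁺ a ∧ (fibre x a ∧ nbr a))
      ≡⟨ parity-cong (λ a → sym (∧-assoc (C⁺ a) (fibre x a) (nbr a))) ⟩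
    parity (λ a → (C⁺ ∩ fibre x) a ∧ nbr a)
      ≡⟨ handshake F (C⁺ ∩ fibre x) (C ∩ fibre v) ⟩
    parity (λ b → (C ∩ fibre v) b ∧ nbrParity F (C⁺ ∩ fibre x) b)
      ≡⟨ oddCount-via-nbrParity oddOrEven C C⁺ (λ b b∈C _ a ba _ → C-closed b∈C ba)
                                (subst T (adj-sym G x v) xv) ⟩
    oddCount C v
      ≡⟨ oddCount-off-x v v≢x ⟩
    true ∎)
    where
    nbr : V F → Bool
    nbr = nbrParity F (C ∩ fibre v)
    s∈fibre : fibre x s ≡ true
    s∈fibre = to T-≡ (fromWitness refl)
    v≢x : ¬ v ≡ x
    v≢x refl = subst T (adj-irrefl G x) xv
    closed : ∀ a → T (C a) → T (fibre x a) → ∀ b → T (adj F a b) → T (fibre v b) → T (C b)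
    closed a a∈C _ b ab bv = closed-off-x a∈C ab (λ φb≡x → v≢x (trans (sym (toWitness bv)) φb≡x))

  -- If x is isolated in G, so is every vertex of its fibre in F; such a vertex cannot lie in
  -- the connected set C, which meets the fibre of v₀ ≠ x.
  q-isolated : (∀ w → ¬ T (adj G x w)) → q ≡ false
  q-isolated isolated = parity-false none
    where
    C-meets-v₀ : ∃[ b ] T (C b) × φ b ≡ v₀
    C-meets-v₀ = let b , t = parity-witness _ C-odd-v₀
                     b∈C , t′ = to T-∧ t
                 in b , b∈C , toWitness (proj₂ (to (T-∧ {odd b}) t′))
    none : ∀ a → C a ∧ (odd a ∧ fibre x a) ≡ false
    none a with C a in Ca | fibre x a in xa
    ... | false | _     = refl
    ... | true  | false = ∧-zeroʳ (odd a)
    ... | true  | true  = ⊥-elim (v₀≢x (trans (sym φb≡v₀) (trans (cong φ (sym a≡b)) φa≡x)))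
      where
      b = proj₁ C-meets-v₀
      φb≡v₀ = proj₂ (proj₂ C-meets-v₀)
      φa≡x : φ a ≡ x
      φa≡x = toWitness (from T-≡ xa)
      a≡b : a ≡ b
      a≡b = reach-from-isolated
        (λ c ac → isolated (φ c) (subst (λ u → T (adj G u (φ c))) φa≡x (hom a c tt tt ac)))
        (C-connected (from T-≡ Ca) (proj₁ (proj₂ C-meets-v₀)))

  nbrFibre⁺-s : ∀ v → T (adj G x v) → oddᵇ (nbrFibre F G C⁺ φ s v) ≡ not q
  nbrFibre⁺-s v xv = begin
    oddᵇ (nbrFibre F G C⁺ φ s v) ≡⟨ oddᵇ-nbrFibre-cong C⁺ C s C⁺≗C v ⟩
    oddᵇ (nbrFibre F G C φ s v)  ≡⟨ oddᵇ-nbrFibre C s v ⟩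
    nbrParity F (C ∩ fibre v) s  ≡⟨ nbrParity-s v xv ⟩
    not q                        ∎
    where
    C⁺≗C : ∀ b → T (adj F s b) → C⁺ b ≡ C b
    C⁺≗C b sb = trans (cong (C b ∨_) (to T-not-≡ (from (T-minus F s) s≢b))) (∨-identityʳ (C b))
      where
      s≢b : ¬ b ≡ s
      s≢b refl = subst T (adj-irrefl F s) sb

  odd⁺-s : odd⁺ s ≡ not q
  odd⁺-s with any? (λ w → T? (adj G x w))
  ... | yes ∃nbr = isOddᵇ-uniform C⁺ s (not q) ∃nbr nbrFibre⁺-s
  ... | no  ∄nbr = trans (isOddᵇ-isolated C⁺ s isolated) (cong not (sym (q-isolated isolated)))
    where
    isolated : ∀ w → ¬ T (adj G x w)
    isolated w xw = ∄nbr (w , xw)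

  odd⁺≡odd : ∀ {a} → T (C a) → odd⁺ a ≡ odd a
  odd⁺≡odd {a} a∈C = isOddᵇ-cong C⁺ (full F) a (λ b ab → to T-≡ (C-closed a∈C ab))

  even⁺≡even : ∀ {a} → T (C a) → isEvenᵇ F G C⁺ φ a ≡ isEvenᵇ F G (full F) φ a
  even⁺≡even {a} a∈C = isEvenᵇ-cong C⁺ (full F) a (λ b ab → to T-≡ (C-closed a∈C ab))

  oddOrEven⁺ : ∀ a → T (C⁺ a) → IsOddVertex F G C⁺ φ a ⊎ IsEvenVertex F G C⁺ φ a
  oddOrEven⁺ a a∈C⁺ with to (T-insert F C s) a∈C⁺
  ... | inj₂ refl = oddOrEven-uniform C⁺ s (not q) nbrFibre⁺-s
  ... | inj₁ a∈C with oddOrEven a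
  ...   | inj₁ isOdd  = inj₁ (subst T (sym (odd⁺≡odd a∈C)) isOdd)
  ...   | inj₂ isEven = inj₂ (subst T (sym (even⁺≡even a∈C)) isEven)

  oddCount⁺ : ∀ v → count (λ a → C⁺ a ∧ (odd⁺ a ∧ fibre v a)) % 2 ≡ 1
  oddCount⁺ v = from (count%2≡1⇔parity (λ a → C⁺ a ∧ (odd⁺ a ∧ fibre v a))) (begin
    parity (λ a → C⁺ a ∧ (odd⁺ a ∧ fibre v a))
      ≡⟨ parity-insert C s (λ a → odd⁺ a ∧ fibre v a) s∉C ⟩
    parity (λ a → C a ∧ (odd⁺ a ∧ fibre v a)) xor (odd⁺ s ∧ fibre v s)
      ≡⟨ cong (_xor (odd⁺ s ∧ fibre v s)) (parity-cong restrict) ⟩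
    oddCount C v xor (odd⁺ s ∧ fibre v s)
      ≡⟨ balance (x ≟ v) ⟩
    true ∎)
    where
    restrict : ∀ a → C a ∧ (odd⁺ a ∧ fibre v a) ≡ C a ∧ (odd a ∧ fibre v a)
    restrict a with C a in Ca
    ... | false = refl
    ... | true  = cong (_∧ fibre v a) (odd⁺≡odd (from T-≡ Ca))
    balance : (x≟v : Dec (x ≡ v)) → oddCount C v xor (odd⁺ s ∧ isYes x≟v) ≡ true
    balance (yes refl) =
      trans (cong (q xor_) (trans (∧-identityʳ (odd⁺ s)) odd⁺-s)) (xor-inverseʳ q)
    balance (no  x≢v)  = cong₂ _xor_ (oddCount-off-x v (x≢v ∘ sym)) (∧-zeroʳ (odd⁺ s))

  oddomorphism⁺ : IsOddomorphism F G C⁺ φ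
  oddomorphism⁺ = (λ a b _ _ ab → hom a b tt tt ab) , oddOrEven⁺ , oddCount⁺

  odd⇔odd⁺ : ∀ a → T (C a) → IsOddVertex F G (full F) φ a ⇔ IsOddVertex F G C⁺ φ a
  odd⇔odd⁺ a a∈C = mk⇔ (subst T (sym (odd⁺≡odd a∈C))) (subst T (odd⁺≡odd a∈C))

  odd⁺-s⇒odd-outside : IsOddVertex F G C⁺ φ s →
    Σ (V F) (λ s* → ¬ T (C s*) × IsOddVertex F G (full F) φ s* × φ s* ≡ x)
  odd⁺-s⇒odd-outside odd⁺s =
    let s* , t = parity-witness _ outside
        s*∉C , t′ = to T-∧ t
        s*-odd , s*∈fibre = to T-∧ t′
    in s* , (λ s*∈C → subst T (to T-not-≡ s*∉C) s*∈C) , s*-odd , toWitness s*∈fibre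
    where
    q≡false : q ≡ false
    q≡false = to T-not-≡ (from T-≡ (trans (sym odd⁺-s) (to T-≡ odd⁺s)))
    outside : parity (λ a → not (C a) ∧ (odd a ∧ fibre x a)) ≡ true
    outside = begin
      parity (λ a → not (C a) ∧ (odd a ∧ fibre x a))
        ≡⟨ cong (_xor parity (λ a → not (C a) ∧ (odd a ∧ fibre x a))) q≡false ⟨
      q xor parity (λ a → not (C a) ∧ (odd a ∧ fibre x a))
        ≡⟨ parity-split C (λ a → odd a ∧ fibre x a) ⟨
      parity (λ a → odd a ∧ fibre x a)
        ≡⟨ to (count%2≡1⇔parity (λ a → odd a ∧ fibre x a)) (proj₂ (proj₂ oddomorphism) x) ⟩
      true ∎

lemma4p3 : (F G : Graph) (φ : V F → V G) → IsOddomorphism F G (full F) φ →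
    (s : V F) → ConnectedMinus G (φ s) →
    Σ (Subset F) (λ C → IsComponentMinus F s C ×
      Σ (V F → V G) (λ φi →
        IsOddomorphism F G (insert F C s) φi ×
        (∀ a → T (insert F C s a) → φi a ≡ φ a) ×
        (∀ a → T (C a) →
          (IsOddVertex F G (full F) φ a ⇔ IsOddVertex F G (insert F C s) φi a)) ×
        (IsOddVertex F G (insert F C s) φi s →
          Σ (V F) (λ s* → ¬ T (C s*) × IsOddVertex F G (full F) φ s* × φ s* ≡ φ s))))
lemma4p3 F G φ oddomorphism s connected@((v₀ , v₀≢x) , _)
  with ∃-odd-component F G φ oddomorphism s v₀ v₀≢x
... | c , c≢s , C-odd-v₀ =
  C , isComponent , φ , oddomorphism⁺ , (λ _ _ → refl) , odd⇔odd⁺ , odd⁺-s⇒odd-outside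
  where
  open Component F s c c≢s
  open Restriction F G φ oddomorphism s connected C s∉C C-closed C-connected C-odd-v₀
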